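{- Let $g$ be a finite dimensional semi-simple complex Lie algebra with Killing form $\kappa$, let $N=\dim_{\mathbb{C}} g$, fix a basis of $g$ (so that $\operatorname{ad}: g\to \operatorname{End}_{\mathbb{C}}(g)\cong \mathfrak{gl}_N(\mathbb{C})$), and let $\Phi := \iota_N\circ(1\otimes \operatorname{ad}) : g[t,t^{ -1}]\to \mathfrak{gl}_N[t,t^{ -1}]\to \mathbf{gl}(\infty)$ be the extended adjoint representation. Then the universal extension $\widehat{g}$ of $g[t,t^{ -1}]$ is the pull-back of $\widehat{\mathbf{gl}}(\infty)$ via $\Phi$; that is, for all $X=\sum_i t^i\otimes x_i$ and $Y=\sum_j t^j\otimes y_j$ in $g[t,t^{ -1}]$, $$\mathrm{c}(\Phi(X),\Phi(Y)) = u(X,Y)=\sum_i i\,\kappa(x_i,y_{ -i}).$$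
   Context: $g[t,t^{ -1}]=\mathbb{C}[t,t^{ -1}]\otimes_{\mathbb{C}} g$ is the loop algebra with bracket $[f\otimes x,h\otimes y]=fh\otimes[x,y]$. Its universal extension $\widehat{g}$ is the central extension $\mathbb{C}\oplus g[t,t^{ -1}]$ defined by the 2-cocycle $u\left(\sum_i t^i\otimes x_i,\sum_j t^j\otimes y_j\right)=\sum_i i\,\kappa(x_i,y_{ -i})$. $\mathbf{gl}(\infty)$ is the Lie algebra (commutator bracket) of $\mathbb{Z}\times\mathbb{Z}$ complex matrices $A=(a_{ij})$ with $a_{ij}=0$ for $|i-j|\gg 0$; $\mathrm{E}_{ij}$ denotes the matrix unit. The 2-cocycle $\mathrm{c}$ on $\mathbf{gl}(\infty)$ is $\mathrm{c}(A,B)=\sum_{i\le 0,k>0}a_{ik}b_{ki}-\sum_{i>0,k\le 0}a_{ik}b_{ki}$, and $\widehat{\mathbf{gl}}(\infty)=\mathbb{C}\oplus\mathbf{gl}(\infty)$ with bracket $[(a,x),(b,y)]=(\mathrm{c}(x,y),[x,y])$. For $N\ge1$, $\iota_N:\mathfrak{gl}_N[t,t^{ -1}]=\mathbb{C}[t,t^{ -1}]\otimes\mathfrak{gl}_N(\mathbb{C})\to\mathbf{gl}(\infty)$ is the Lie algebra monomorphism $t^m\otimes e_{ij}\mapsto\sum_{k\in\mathbb{Z}}\mathrm{E}_{N(k-m)+i,\,Nk+j}$ ($1\le i,j\le N$, $m\in\mathbb{Z}$), extended linearly, where $e_{ij}$ are the matrix units of $\mathfrak{gl}_N$; $1\otimes\operatorname{ad}$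 sends $t^m\otimes x\mapsto t^m\otimes\operatorname{ad}x$. -}

module Defs where

open import Level using (Level; _⊔_) renaming (suc to lsuc)
open import Algebra.Bundles using (CommutativeRing)
open import Data.Nat as ℕ using (ℕ; zero; suc)
import Data.Nat.Properties as ℕP
open import Data.Integer as ℤ using (ℤ; +_; -[1+_]; ∣_∣)
import Data.Integer.Properties as ℤP
open import Data.Integer.DivMod using (_/ℕ_; _%ℕ_; n%ℕd<d; a≡a%ℕn+[a/ℕn]*n)
open import Data.Integer.Tactic.RingSolver using (solve-∀)
open import Data.Fin using (Fin; fromℕ<)
import Data.Fin as Fin
open import Data.List using (List; []; _∷_)
open import Data.Product using (_×_; _,_; ∃; Σ-syntax)
open import Relation.Nullary.Decidable using (⌊_⌋; yes; no)
open import Data.Bool using (if_then_else_; true; false)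
open import Relation.Binary.PropositionalEquality as Eq using (_≡_)

-- For N = suc n, an integer p is written uniquely as p = N·a + r + 1 with
-- a ∈ ℤ and r ∈ {0,…,N-1}; blk gives a, pos gives r (as Fin N).
blk : (n : ℕ) → ℤ → ℤ
blk n p = (p ℤ.- ℤ.1ℤ) /ℕ suc n

pos : (n : ℕ) → ℤ → Fin (suc n)
pos n p = fromℕ< (n%ℕd<d (p ℤ.- ℤ.1ℤ) (suc n))

private
  decomp : ∀ n p → p ≡ + Fin.toℕ (pos n p) ℤ.+ blk n p ℤ.* + suc n ℤ.+ ℤ.1ℤ
  decomp n p = Eq.trans (Eq.sym (lemma p))
                 (Eq.cong (λ z → z ℤ.+ ℤ.1ℤ)
                   (Eq.trans (a≡a%ℕn+[a/ℕn]*n (p ℤ.- ℤ.1ℤ) (suc n))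
                     (Eq.cong (λ z → + z ℤ.+ blk n p ℤ.* + suc n)
                       (Eq.sym (Data.Fin.Properties.toℕ-fromℕ< _)))))
    where
    import Data.Fin.Properties
    lemma : ∀ p → p ℤ.- ℤ.1ℤ ℤ.+ ℤ.1ℤ ≡ p
    lemma = solve-∀

  finDist : ∀ {N} (r s : Fin N) → ∣ + Fin.toℕ r ℤ.- + Fin.toℕ s ∣ ℕ.≤ N
  finDist {N} r s =
    ℕP.≤-trans (Eq.subst (λ z → ∣ z ∣ ℕ.≤ Fin.toℕ r ℕ.⊔ Fin.toℕ s) (Eq.sym (ℤP.m-n≡m⊖n (Fin.toℕ r) (Fin.toℕ s)))
                  (ℤP.∣m⊝n∣≤m⊔n (Fin.toℕ r) (Fin.toℕ s)))
               (ℕP.⊔-lub (ℕP.<⇒≤ (Data.Fin.Properties.toℕ<n r))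
                         (ℕP.<⇒≤ (Data.Fin.Properties.toℕ<n s)))
    where import Data.Fin.Properties

bandLemma : ∀ n p q m → blk n q ℤ.- blk n p ≡ m →
            ∣ p ℤ.- q ∣ ℕ.≤ suc n ℕ.* suc ∣ m ∣
bandLemma n p q m eq = goal
  where
  r = + Fin.toℕ (pos n p)
  s = + Fin.toℕ (pos n q)
  a = blk n p
  b = blk n q
  N = + suc n
  alg : ∀ r s a b N → (r ℤ.+ a ℤ.* N ℤ.+ ℤ.1ℤ) ℤ.- (s ℤ.+ b ℤ.* N ℤ.+ ℤ.1ℤ)
                      ≡ (r ℤ.- s) ℤ.- (b ℤ.- a) ℤ.* N
  alg = solve-∀
  pq : p ℤ.- q ≡ (r ℤ.- s) ℤ.- m ℤ.* N
  pq = Eq.trans (Eq.cong₂ ℤ._-_ (decomp n p) (decomp n q))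
         (Eq.trans (alg r s a b N) (Eq.cong (λ z → (r ℤ.- s) ℤ.- z ℤ.* N) eq))
  goal : ∣ p ℤ.- q ∣ ℕ.≤ suc n ℕ.* suc ∣ m ∣
  goal = Eq.subst (λ z → ∣ z ∣ ℕ.≤ suc n ℕ.* suc ∣ m ∣) (Eq.sym pq)
    (ℕP.≤-trans (ℤP.∣i-j∣≤∣i∣+∣j∣ (r ℤ.- s) (m ℤ.* N))
      (Eq.subst (λ z → ∣ r ℤ.- s ∣ ℕ.+ z ℕ.≤ suc n ℕ.* suc ∣ m ∣) (Eq.sym (ℤP.∣i*j∣≡∣i∣*∣j∣ m N))
        (Eq.subst (λ z → ∣ r ℤ.- s ∣ ℕ.+ ∣ m ∣ ℕ.* suc n ℕ.≤ z)
           (ℕP.*-comm (suc ∣ m ∣) (suc n))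
           (ℕP.+-monoˡ-≤ (∣ m ∣ ℕ.* suc n) (finDist (pos n p) (pos n q))))))

module _ {c ℓ : Level} (K : CommutativeRing c ℓ) where
  open CommutativeRing K

  Σ< : ℕ → (ℕ → Carrier) → Carrier
  Σ< zero    f = 0#
  Σ< (suc n) f = Σ< n f + f n

  ΣF : (N : ℕ) → (Fin N → Carrier) → Carrier
  ΣF zero    f = 0#
  ΣF (suc N) f = f Fin.zero + ΣF N (λ r → f (Fin.suc r))

  ℕ→K : ℕ → Carrier
  ℕ→K zero    = 0#
  ℕ→K (suc n) = 1# + ℕ→K n

  ℤ→K : ℤ → Carrier
  ℤ→K (+ n)      = ℕ→K n
  ℤ→K -[1+ n ]   = - ℕ→K (suc n)

  Vec : ℕ → Set c
  Vec N = Fin N → Carrier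

  _≈ᵥ_ : ∀ {N} → Vec N → Vec N → Set ℓ
  x ≈ᵥ y = ∀ r → x r ≈ y r

  0ᵥ : ∀ {N} → Vec N
  0ᵥ _ = 0#

  -- A Lie algebra structure on K^N given by its structure constants
  -- w.r.t. the basis: [e_a , e_b] = Σ_k C a b k e_k.
  record LieAlgebra (N : ℕ) : Set (c ⊔ ℓ) where
    field
      C : Fin N → Fin N → Fin N → Carrier
      alternating : ∀ a k → C a a k ≈ 0#
      antisym     : ∀ a b k → C a b k + C b a k ≈ 0#
      jacobi      : ∀ a b d k →
        ΣF N (λ m → C a b m * C m d k + C b d m * C m a k + C d a m * C m b k) ≈ 0#

    bracket : Vec N → Vec N → Vec N
    bracket x y k = ΣF N (λ a → ΣF N (λ b → x a * y b * C a b k))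

    -- matrix of ad x: (ad x) r s = coefficient of e_r in [x , e_s]
    ad : Vec N → Fin N → Fin N → Carrier
    ad x r s = ΣF N (λ a → x a * C a s r)

    κ : Vec N → Vec N → Carrier
    κ x y = ΣF N (λ r → ΣF N (λ s → ad x r s * ad y s r))

    Pred : Set (lsuc (c ⊔ ℓ))
    Pred = Vec N → Set (c ⊔ ℓ)

    record IsSubspace (P : Pred) : Set (c ⊔ ℓ) where
      field
        resp  : ∀ {x y} → x ≈ᵥ y → P x → P y
        zero∈ : P 0ᵥ
        add∈  : ∀ {x y} → P x → P y → P (λ r → x r + y r)
        scal∈ : ∀ λ' {x} → P x → P (λ r → λ' * x r)

    record IsIdeal (P : Pred) : Set (c ⊔ ℓ) where
      field
        subspace : IsSubspace P
        bracket∈ : ∀ x {y} → P y → P (bracket x y)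

    data Span (S : Pred) : Pred where
      gen  : ∀ {x} → S x → Span S x
      zer  : Span S 0ᵥ
      add  : ∀ {x y} → Span S x → Span S y → Span S (λ r → x r + y r)
      scal : ∀ λ' {x} → Span S x → Span S (λ r → λ' * x r)
      resp : ∀ {x y} → x ≈ᵥ y → Span S x → Span S y

    derived : ℕ → Pred → Pred
    derived zero    P = P
    derived (suc n) P =
      Span (λ v → ∃ λ x → ∃ λ y → derived n P x × derived n P y × (v ≈ᵥ bracket x y))

    Solvable : Pred → Set (c ⊔ ℓ)
    Solvable P = ∃ λ n → ∀ v → derived n P v → v ≈ᵥ 0ᵥ

    Semisimple : Set (lsuc (c ⊔ ℓ))
    Semisimple = ∀ (P : Pred) → IsIdeal P → Solvable P → ∀ v → P v → v ≈ᵥ 0ᵥ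

  -- Elements of g[t,t⁻¹] = K[t,t⁻¹] ⊗ g: finite formal sums Σ t^m ⊗ x,
  -- given as a list of pairs (m , x) (repetitions of m allowed).
  Loop : ℕ → Set c
  Loop N = List (ℤ × Vec N)

  coeff : ∀ {N} → Loop N → ℤ → Vec N
  coeff []            i r = 0#
  coeff ((m , x) ∷ X) i r with m ℤ.≟ i
  ... | yes _ = x r + coeff X i r
  ... | no  _ = coeff X i r

  deg : ∀ {N} → Loop N → ℕ
  deg []            = 0
  deg ((m , x) ∷ X) = ∣ m ∣ ℕ.⊔ deg X

  -- The 2-cocycle u(X,Y) = Σ_i i κ(x_i , y_{-i})  (i ranging over [-M, M],
  -- outside of which x_i = 0)
  u : ∀ {N} → LieAlgebra N → Loop N → Loop N → Carrier
  u {N} L X Y = Σ< (suc (2 ℕ.* M))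
      (λ j → let i = + j ℤ.- + M in ℤ→K i * κ (coeff X i) (coeff Y (ℤ.- i)))
    where
    open LieAlgebra L
    M = deg X

  record gl∞ : Set (c ⊔ ℓ) where
    field
      entry  : ℤ → ℤ → Carrier
      band   : ℕ
      banded : ∀ p q → band ℕ.< ∣ p ℤ.- q ∣ → entry p q ≈ 0#
  open gl∞

  -- the cocycle c(A,B) = Σ_{i≤0<k} a_ik b_ki − Σ_{k≤0<i} a_ik b_ki;
  -- only |i - k| ≤ band A contributes, i.e. i ∈ {0,…,-(R-1)}, k ∈ {1,…,R}.
  cocycle : gl∞ → gl∞ → Carrier
  cocycle A B =
      Σ< R (λ i → Σ< R (λ k → entry A (ℤ.- + i) (+ suc k) * entry B (+ suc k) (ℤ.- + i)))
    - Σ< R (λ i → Σ< R (λ k → entry A (+ suc i) (ℤ.- + k) * entry B (ℤ.- + k) (+ suc i)))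
    where R = band A

  -- Φ = ι_N ∘ (1 ⊗ ad) on a single term t^m ⊗ x, entry (p , q):
  -- ι_N (t^m ⊗ e_ij) = Σ_k E_{N(k-m)+i, Nk+j}; writing p = N a + r + 1,
  -- q = N b + s + 1 (0 ≤ r,s < N, r = i-1, s = j-1) the entry is (ad x)_{rs}
  -- if b - a = m, and 0 otherwise.
  Φterm : ∀ {N} → LieAlgebra N → ℤ → Vec N → ℤ → ℤ → Carrier
  Φterm {zero}  L m x p q = 0#
  Φterm {suc n} L m x p q with blk n q ℤ.- blk n p ℤ.≟ m
  ... | yes _ = LieAlgebra.ad L x (pos n p) (pos n q)
  ... | no  _ = 0#

  Φentry : ∀ {N} → LieAlgebra N → Loop N → ℤ → ℤ → Carrier
  Φentry L []            p q = 0#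
  Φentry L ((m , x) ∷ X) p q = Φterm L m x p q + Φentry L X p q

  private
    Φterm-band : ∀ {N} (L : LieAlgebra N) m x p q →
                 N ℕ.* suc ∣ m ∣ ℕ.< ∣ p ℤ.- q ∣ → Φterm L m x p q ≈ 0#
    Φterm-band {zero}  L m x p q _ = refl
    Φterm-band {suc n} L m x p q lt with blk n q ℤ.- blk n p ℤ.≟ m
    ... | yes e = ⊥-elim (ℕP.<⇒≱ lt (bandLemma n p q m e))
      where open import Data.Empty using (⊥-elim)
    ... | no  _ = refl

    Φentry-band : ∀ {N} (L : LieAlgebra N) X p q →
                  N ℕ.* suc (deg X) ℕ.< ∣ p ℤ.- q ∣ → Φentry L X p q ≈ 0#
    Φentry-band L [] p q _ = refl
    Φentry-band {N} L ((m , x) ∷ X) p q lt =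
      trans (+-cong (Φterm-band L m x p q
                      (ℕP.≤-<-trans (ℕP.*-monoʳ-≤ N (ℕ.s≤s (ℕP.m≤m⊔n ∣ m ∣ (deg X)))) lt))
                    (Φentry-band L X p q
                      (ℕP.≤-<-trans (ℕP.*-monoʳ-≤ N (ℕ.s≤s (ℕP.m≤n⊔m ∣ m ∣ (deg X)))) lt)))
            (+-identityˡ 0#)

  Φ : ∀ {N} → LieAlgebra N → Loop N → gl∞
  Φ {N} L X = record
    { entry  = Φentry L X
    ; band   = N ℕ.* suc (deg X)
    ; banded = Φentry-band L X
    }

-- Write an integer as p = N a + r + 1 with 0 ≤ r < N (block a, position r).  The
-- (p, q) entry of Φ(X) is (ad x_{b−a})_{rs}, where b, s are the block and position
-- of q.  In c(Φ X, Φ Y) the terms with p in block a < 0 and q in block b ≥ 0 sum,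
-- over positions, to tr(ad x_m ∘ ad y_{−m}) = κ(x_m, y_{−m}) with m = b − a, and
-- exactly m pairs of blocks give the same m > 0.  So the first half of c is
-- Σ_{m>0} m κ(x_m, y_{−m}), the second half Σ_{m>0} m κ(x_{−m}, y_m), and their
-- difference is u(X, Y).
module Submission where

open import Defs
open import Level using (Level; _⊔_)
open import Algebra.Bundles using (CommutativeRing)
import Algebra.Properties.AbelianGroup as AbelianGroupProperties
import Algebra.Properties.CommutativeSemigroup as CommutativeSemigroupProperties
import Algebra.Properties.Ring as RingProperties
open import Data.Nat as ℕ using (ℕ; zero; suc)
import Data.Nat.Properties as ℕP
open import Data.Integer as ℤ using (ℤ; +_; -[1+_]; ∣_∣)
import Data.Integer.Properties as ℤP
open import Data.Integer.DivMod using (n%ℕd<d; a≡a%ℕn+[a/ℕn]*n)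
open import Data.Integer.Tactic.RingSolver using (solve-∀)
open import Data.Fin as Fin using (Fin)
import Data.Fin.Properties as FinP
open import Data.Product using (_×_; _,_; proj₁; proj₂)
open import Data.List using ([]; _∷_)
open import Relation.Binary.PropositionalEquality as ≡ using (_≡_)
open import Relation.Nullary using (yes; no)
open import Data.Empty using (⊥-elim)

∣+m-+n∣<N : ∀ {N m n} → m ℕ.< N → n ℕ.< N → ∣ + m ℤ.- + n ∣ ℕ.< N
∣+m-+n∣<N {m = m} {n} m<N n<N =
  ≡.subst (ℕ._< _) (≡.cong ∣_∣ (≡.sym (ℤP.m-n≡m⊖n m n)))
    (ℕP.≤-<-trans (ℤP.∣m⊝n∣≤m⊔n m n) (ℕP.⊔-lub m<N n<N))

euclid-unique : ∀ N {r r'} q q' → r ℕ.< N → r' ℕ.< N →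
                + r ℤ.+ q ℤ.* + N ≡ + r' ℤ.+ q' ℤ.* + N → q ≡ q' × r ≡ r'
euclid-unique N {r} {r'} q q' r<N r'<N eq = q≡q' , r≡r'
  where
  shift : (q ℤ.- q') ℤ.* + N ≡ + r' ℤ.- + r
  shift = ≡.trans (lhs (+ r) q q' (+ N))
            (≡.trans (≡.cong (ℤ._- (+ r ℤ.+ q' ℤ.* + N)) eq) (rhs (+ r) (+ r') q' (+ N)))
    where
    lhs : ∀ r q q' N → (q ℤ.- q') ℤ.* N ≡ (r ℤ.+ q ℤ.* N) ℤ.- (r ℤ.+ q' ℤ.* N)
    lhs = solve-∀
    rhs : ∀ r r' q' N → (r' ℤ.+ q' ℤ.* N) ℤ.- (r ℤ.+ q' ℤ.* N) ≡ r' ℤ.- r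
    rhs = solve-∀
  ∣q-q'∣*N<1*N : ∣ q ℤ.- q' ∣ ℕ.* N ℕ.< 1 ℕ.* N
  ∣q-q'∣*N<1*N = ≡.subst₂ ℕ._<_
    (≡.trans (≡.cong ∣_∣ (≡.sym shift)) (ℤP.∣i*j∣≡∣i∣*∣j∣ (q ℤ.- q') (+ N)))
    (≡.sym (ℕP.*-identityˡ N))
    (∣+m-+n∣<N r'<N r<N)
  q≡q' : q ≡ q'
  q≡q' = ℤP.i-j≡0⇒i≡j q q' (ℤP.∣i∣≡0⇒i≡0 (ℕP.n<1⇒n≡0 (ℕP.*-cancelʳ-< N _ _ ∣q-q'∣*N<1*N)))
  r'-r≡0 : + r' ℤ.- + r ≡ + 0
  r'-r≡0 = ≡.trans (≡.sym shift)
             (≡.trans (≡.cong (λ z → (z ℤ.- q') ℤ.* + N) q≡q') (≡.cong (ℤ._* + N) (ℤP.+-inverseʳ q')))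
  r≡r' : r ≡ r'
  r≡r' = ≡.sym (ℤP.+-injective (ℤP.i-j≡0⇒i≡j (+ r') (+ r) r'-r≡0))

blk-pos-unique : ∀ n p b {ρ} → ρ ℕ.< suc n → p ℤ.- ℤ.1ℤ ≡ + ρ ℤ.+ b ℤ.* + suc n →
                 blk n p ≡ b × Fin.toℕ (pos n p) ≡ ρ
blk-pos-unique n p b ρ<N eq
  with euclid-unique (suc n) (blk n p) b (n%ℕd<d (p ℤ.- ℤ.1ℤ) (suc n)) ρ<N
         (≡.trans (≡.sym (a≡a%ℕn+[a/ℕn]*n (p ℤ.- ℤ.1ℤ) (suc n))) eq)
... | blk≡b , r≡ρ = blk≡b , ≡.trans (FinP.toℕ-fromℕ< _) r≡ρ

+[m*n+o]≡+m*+n++o : ∀ m n o → + (m ℕ.* n ℕ.+ o) ≡ + m ℤ.* + n ℤ.+ + o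
+[m*n+o]≡+m*+n++o m n o = ≡.trans (ℤP.pos-+ (m ℕ.* n) o) (≡.cong (ℤ._+ + o) (ℤP.pos-* m n))

positive-point : ∀ n a ρ → + suc (suc n ℕ.* a ℕ.+ ρ) ℤ.- ℤ.1ℤ ≡ + ρ ℤ.+ + a ℤ.* + suc n
positive-point n a ρ =
  ≡.trans (≡.cong (λ z → ℤ.1ℤ ℤ.+ z ℤ.- ℤ.1ℤ) (+[m*n+o]≡+m*+n++o (suc n) a ρ)) (alg (+ a) (+ suc n) (+ ρ))
  where
  alg : ∀ a N ρ → ℤ.1ℤ ℤ.+ (N ℤ.* a ℤ.+ ρ) ℤ.- ℤ.1ℤ ≡ ρ ℤ.+ a ℤ.* N
  alg = solve-∀

nonpositive-point : ∀ n a ρ → ρ ℕ.≤ n →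
  ℤ.- + (suc n ℕ.* a ℕ.+ ρ) ℤ.- ℤ.1ℤ ≡ + (n ℕ.∸ ρ) ℤ.+ -[1+ a ] ℤ.* + suc n
nonpositive-point n a ρ ρ≤n = begin
  ℤ.- + (suc n ℕ.* a ℕ.+ ρ) ℤ.- ℤ.1ℤ
    ≡⟨ ≡.cong (λ z → ℤ.- z ℤ.- ℤ.1ℤ) (+[m*n+o]≡+m*+n++o (suc n) a ρ) ⟩
  ℤ.- ((ℤ.1ℤ ℤ.+ + n) ℤ.* + a ℤ.+ + ρ) ℤ.- ℤ.1ℤ
    ≡⟨ alg (+ a) (+ n) (+ ρ) ⟩
  (+ n ℤ.- + ρ) ℤ.+ ℤ.- (ℤ.1ℤ ℤ.+ + a) ℤ.* (ℤ.1ℤ ℤ.+ + n)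
    ≡⟨ ≡.cong (ℤ._+ -[1+ a ] ℤ.* + suc n) (≡.trans (ℤP.m-n≡m⊖n n ρ) (ℤP.⊖-≥ ρ≤n)) ⟩
  + (n ℕ.∸ ρ) ℤ.+ -[1+ a ] ℤ.* + suc n ∎
  where
  open ≡.≡-Reasoning
  alg : ∀ a n ρ → ℤ.- ((ℤ.1ℤ ℤ.+ n) ℤ.* a ℤ.+ ρ) ℤ.- ℤ.1ℤ ≡ (n ℤ.- ρ) ℤ.+ ℤ.- (ℤ.1ℤ ℤ.+ a) ℤ.* (ℤ.1ℤ ℤ.+ n)
  alg = solve-∀

+[m+n]-+m≡+n : ∀ m n → + (m ℕ.+ n) ℤ.- + m ≡ + n
+[m+n]-+m≡+n m n = ≡.trans (≡.cong (ℤ._- + m) (ℤP.pos-+ m n)) (alg (+ m) (+ n))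
  where
  alg : ∀ m n → m ℤ.+ n ℤ.- m ≡ n
  alg = solve-∀

+[m∸n]-+m≡-+n : ∀ {m n} → n ℕ.≤ m → + (m ℕ.∸ n) ℤ.- + m ≡ ℤ.- + n
+[m∸n]-+m≡-+n {m} {n} n≤m =
  ≡.trans (≡.cong (ℤ._- + m) (≡.sym (≡.trans (ℤP.m-n≡m⊖n m n) (ℤP.⊖-≥ n≤m)))) (alg (+ m) (+ n))
  where
  alg : ∀ m n → (m ℤ.- n) ℤ.- m ≡ ℤ.- n
  alg = solve-∀

+m--[1+n]≡+[1+n+m] : ∀ m n → + m ℤ.- -[1+ n ] ≡ + suc (n ℕ.+ m)
+m--[1+n]≡+[1+n+m] m n = ≡.cong +_ (ℕP.+-comm m (suc n))

-[1+m]-+n≡-[1+n+m] : ∀ m n → -[1+ m ] ℤ.- + n ≡ -[1+ (n ℕ.+ m) ]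
-[1+m]-+n≡-[1+n+m] m zero    = ≡.refl
-[1+m]-+n≡-[1+n+m] m (suc n) = ≡.cong -[1+_] (≡.cong suc (ℕP.+-comm m n))

module _ {c ℓ : Level} (K : CommutativeRing c ℓ) where
  open CommutativeRing K
  open import Relation.Binary.Reasoning.Setoid setoid
  open CommutativeSemigroupProperties +-commutativeSemigroup using (interchange)
  open AbelianGroupProperties +-abelianGroup using (∙-cancelˡ; ⁻¹-∙-comm; ε⁻¹≈ε)
  open RingProperties ring using (-‿distribˡ-*)

  Σ<-cong-< : ∀ n {f g : ℕ → Carrier} → (∀ j → j ℕ.< n → f j ≈ g j) → Σ< K n f ≈ Σ< K n g
  Σ<-cong-< zero    f≈g = refl
  Σ<-cong-< (suc n) f≈g = +-cong (Σ<-cong-< n (λ j j<n → f≈g j (ℕP.m<n⇒m<1+n j<n))) (f≈g n ℕP.≤-refl)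

  Σ<-cong : ∀ n {f g : ℕ → Carrier} → (∀ j → f j ≈ g j) → Σ< K n f ≈ Σ< K n g
  Σ<-cong n f≈g = Σ<-cong-< n (λ j _ → f≈g j)

  Σ<-zero : ∀ n {f : ℕ → Carrier} → (∀ j → f j ≈ 0#) → Σ< K n f ≈ 0#
  Σ<-zero zero    f≈0 = refl
  Σ<-zero (suc n) f≈0 = trans (+-cong (Σ<-zero n f≈0) (f≈0 n)) (+-identityˡ 0#)

  Σ<-distrib-+ : ∀ n (f g : ℕ → Carrier) → Σ< K n (λ j → f j + g j) ≈ Σ< K n f + Σ< K n g
  Σ<-distrib-+ zero    f g = sym (+-identityˡ 0#)
  Σ<-distrib-+ (suc n) f g = trans (+-congʳ (Σ<-distrib-+ n f g)) (interchange _ _ _ _)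

  Σ<-neg : ∀ n (f : ℕ → Carrier) → Σ< K n (λ j → - f j) ≈ - Σ< K n f
  Σ<-neg zero    f = sym ε⁻¹≈ε
  Σ<-neg (suc n) f = trans (+-congʳ (Σ<-neg n f)) (⁻¹-∙-comm _ _)

  Σ<-comm : ∀ m n (f : ℕ → ℕ → Carrier) →
            Σ< K m (λ i → Σ< K n (f i)) ≈ Σ< K n (λ j → Σ< K m (λ i → f i j))
  Σ<-comm zero    n f = sym (Σ<-zero n (λ _ → refl))
  Σ<-comm (suc m) n f = trans (+-congʳ (Σ<-comm m n f)) (sym (Σ<-distrib-+ n _ _))

  Σ<-+ : ∀ m n (f : ℕ → Carrier) → Σ< K (m ℕ.+ n) f ≈ Σ< K m f + Σ< K n (λ j → f (m ℕ.+ j))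
  Σ<-+ m zero    f rewrite ℕP.+-identityʳ m = sym (+-identityʳ _)
  Σ<-+ m (suc n) f rewrite ℕP.+-suc m n = trans (+-congʳ (Σ<-+ m n f)) (+-assoc _ _ _)

  Σ<-suc : ∀ n (f : ℕ → Carrier) → Σ< K (suc n) f ≈ f 0 + Σ< K n (λ j → f (suc j))
  Σ<-suc zero    f = +-comm _ _
  Σ<-suc (suc n) f = trans (+-congʳ (Σ<-suc n f)) (+-assoc _ _ _)

  Σ<-reverse : ∀ n (f : ℕ → Carrier) → Σ< K n f ≈ Σ< K n (λ j → f (n ℕ.∸ suc j))
  Σ<-reverse zero    f = refl
  Σ<-reverse (suc n) f = begin
    Σ< K n f + f n                           ≈⟨ +-congʳ (Σ<-reverse n f) ⟩
    Σ< K n (λ j → f (n ℕ.∸ suc j)) + f n     ≈⟨ +-comm _ _ ⟩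
    f n + Σ< K n (λ j → f (n ℕ.∸ suc j))     ≈⟨ Σ<-suc n (λ j → f (n ℕ.∸ j)) ⟨
    Σ< K (suc n) (λ j → f (n ℕ.∸ j))         ∎

  Σ<-blocks : ∀ N k (f : ℕ → Carrier) →
              Σ< K (N ℕ.* k) f ≈ Σ< K k (λ a → Σ< K N (λ ρ → f (N ℕ.* a ℕ.+ ρ)))
  Σ<-blocks N zero    f rewrite ℕP.*-zeroʳ N = refl
  Σ<-blocks N (suc k) f rewrite ℕP.*-suc N k | ℕP.+-comm N (N ℕ.* k) =
    trans (Σ<-+ (N ℕ.* k) N f) (+-congʳ (Σ<-blocks N k f))

  Σ<-const : ∀ n x → Σ< K n (λ _ → x) ≈ ℕ→K K n * x
  Σ<-const zero    x = sym (zeroˡ x)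
  Σ<-const (suc n) x = begin
    Σ< K n (λ _ → x) + x       ≈⟨ +-cong (Σ<-const n x) (sym (*-identityˡ x)) ⟩
    ℕ→K K n * x + 1# * x       ≈⟨ +-comm _ _ ⟩
    1# * x + ℕ→K K n * x       ≈⟨ distribʳ x 1# (ℕ→K K n) ⟨
    (1# + ℕ→K K n) * x         ∎

  Σ<-stable : ∀ {M} n {f : ℕ → Carrier} → (∀ j → M ℕ.≤ j → f j ≈ 0#) → M ℕ.≤ n →
              Σ< K n f ≈ Σ< K M f
  Σ<-stable {M} n {f} f≈0 M≤n = begin
    Σ< K n f                                         ≡⟨ ≡.cong (λ m → Σ< K m f) (ℕP.m+[n∸m]≡n M≤n) ⟨
    Σ< K (M ℕ.+ (n ℕ.∸ M)) f                         ≈⟨ Σ<-+ M (n ℕ.∸ M) f ⟩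
    Σ< K M f + Σ< K (n ℕ.∸ M) (λ j → f (M ℕ.+ j))    ≈⟨ +-congˡ (Σ<-zero (n ℕ.∸ M) (λ j → f≈0 (M ℕ.+ j) (ℕP.m≤m+n M j))) ⟩
    Σ< K M f + 0#                                    ≈⟨ +-identityʳ _ ⟩
    Σ< K M f                                         ∎

  summation-by-parts : ∀ k (h : ℕ → Carrier) →
    Σ< K k (λ a → Σ< K a h) + Σ< K k (λ j → ℕ→K K (suc j) * h j) ≈ ℕ→K K k * Σ< K k h
  summation-by-parts zero    h = trans (+-identityˡ 0#) (sym (zeroˡ 0#))
  summation-by-parts (suc k) h = begin
    (Σ< K k H + H k) + (W + ℕ→K K (suc k) * h k)      ≈⟨ interchange _ _ _ _ ⟩
    (Σ< K k H + W) + (H k + ℕ→K K (suc k) * h k)      ≈⟨ +-congʳ (summation-by-parts k h) ⟩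
    ℕ→K K k * H k + (H k + ℕ→K K (suc k) * h k)       ≈⟨ +-assoc _ _ _ ⟨
    (ℕ→K K k * H k + H k) + ℕ→K K (suc k) * h k       ≈⟨ +-congʳ (+-comm _ _) ⟩
    (H k + ℕ→K K k * H k) + ℕ→K K (suc k) * h k       ≈⟨ +-congʳ (+-congʳ (sym (*-identityˡ _))) ⟩
    (1# * H k + ℕ→K K k * H k) + ℕ→K K (suc k) * h k  ≈⟨ +-congʳ (distribʳ _ _ _) ⟨
    ℕ→K K (suc k) * H k + ℕ→K K (suc k) * h k         ≈⟨ distribˡ _ _ _ ⟨
    ℕ→K K (suc k) * (H k + h k)                       ∎
    where
    H : ℕ → Carrier
    H a = Σ< K a h
    W : Carrier
    W = Σ< K k (λ j → ℕ→K K (suc j) * h j)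

  Σ<-antidiagonal : ∀ {M} k (h : ℕ → Carrier) → (∀ j → M ℕ.≤ j → h j ≈ 0#) → M ℕ.≤ k →
    Σ< K k (λ a → Σ< K k (λ b → h (a ℕ.+ b))) ≈ Σ< K M (λ j → ℕ→K K (suc j) * h j)
  Σ<-antidiagonal {M} k h h≈0 M≤k = trans
    (∙-cancelˡ (Σ< K k H) _ _ (begin
      Σ< K k H + Σ< K k (λ a → Σ< K k (λ b → h (a ℕ.+ b)))
        ≈⟨ Σ<-distrib-+ k _ _ ⟨
      Σ< K k (λ a → H a + Σ< K k (λ b → h (a ℕ.+ b)))
        ≈⟨ Σ<-cong k (λ a → Σ<-+ a k h) ⟨
      Σ< K k (λ a → H (a ℕ.+ k))
        ≈⟨ Σ<-cong k (λ a → trans (Σ<-stable (a ℕ.+ k) h≈0 (ℕP.≤-trans M≤k (ℕP.m≤n+m k a)))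
                                  (sym (Σ<-stable k h≈0 M≤k))) ⟩
      Σ< K k (λ _ → H k)
        ≈⟨ Σ<-const k (H k) ⟩
      ℕ→K K k * H k
        ≈⟨ summation-by-parts k h ⟨
      Σ< K k H + Σ< K k (λ j → ℕ→K K (suc j) * h j) ∎))
    (Σ<-stable k (λ j M≤j → trans (*-congˡ (h≈0 j M≤j)) (zeroʳ _)) M≤k)
    where
    H : ℕ → Carrier
    H a = Σ< K a h

  Σ<-symmetric : ∀ M (T : ℤ → Carrier) →
    Σ< K (suc (2 ℕ.* M)) (λ j → ℤ→K K (+ j ℤ.- + M) * T (+ j ℤ.- + M))
    ≈ Σ< K M (λ j → ℕ→K K (suc j) * T (+ suc j)) - Σ< K M (λ j → ℕ→K K (suc j) * T -[1+ j ])
  Σ<-symmetric M T = begin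
    Σ< K (suc (2 ℕ.* M)) f
      ≡⟨ ≡.cong (λ m → Σ< K m f) (≡.trans (≡.cong (λ m → suc (M ℕ.+ m)) (ℕP.+-identityʳ M)) (≡.sym (ℕP.+-suc M M))) ⟩
    Σ< K (M ℕ.+ suc M) f
      ≈⟨ Σ<-+ M (suc M) f ⟩
    Σ< K M f + Σ< K (suc M) (λ j → f (M ℕ.+ j))
      ≈⟨ +-congˡ (Σ<-suc M _) ⟩
    Σ< K M f + (f (M ℕ.+ 0) + Σ< K M (λ j → f (M ℕ.+ suc j)))
      ≈⟨ +-cong negative (+-cong centre positive) ⟩
    - W⁻ + (0# + W⁺)
      ≈⟨ +-congˡ (+-identityˡ W⁺) ⟩
    - W⁻ + W⁺
      ≈⟨ +-comm _ _ ⟩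
    W⁺ - W⁻ ∎
    where
    g : ℤ → Carrier
    g i = ℤ→K K i * T i
    f : ℕ → Carrier
    f j = g (+ j ℤ.- + M)
    W⁺ = Σ< K M (λ j → ℕ→K K (suc j) * T (+ suc j))
    W⁻ = Σ< K M (λ j → ℕ→K K (suc j) * T -[1+ j ])
    centre : f (M ℕ.+ 0) ≈ 0#
    centre = trans (reflexive (≡.cong g (+[m+n]-+m≡+n M 0))) (zeroˡ _)
    positive : Σ< K M (λ j → f (M ℕ.+ suc j)) ≈ W⁺
    positive = Σ<-cong M (λ j → reflexive (≡.cong g (+[m+n]-+m≡+n M (suc j))))
    negative : Σ< K M f ≈ - W⁻
    negative = begin
      Σ< K M f                                            ≈⟨ Σ<-reverse M f ⟩
      Σ< K M (λ j → f (M ℕ.∸ suc j))                      ≈⟨ Σ<-cong-< M (λ j j<M →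
        trans (reflexive (≡.cong g (+[m∸n]-+m≡-+n j<M))) (sym (-‿distribˡ-* _ _))) ⟩
      Σ< K M (λ j → - (ℕ→K K (suc j) * T -[1+ j ]))       ≈⟨ Σ<-neg M _ ⟩
      - W⁻                                                ∎

  ΣF-cong : ∀ N {φ ψ : Fin N → Carrier} → (∀ r → φ r ≈ ψ r) → ΣF K N φ ≈ ΣF K N ψ
  ΣF-cong zero    φ≈ψ = refl
  ΣF-cong (suc N) φ≈ψ = +-cong (φ≈ψ Fin.zero) (ΣF-cong N (λ r → φ≈ψ (Fin.suc r)))

  ΣF-zero : ∀ N {φ : Fin N → Carrier} → (∀ r → φ r ≈ 0#) → ΣF K N φ ≈ 0#
  ΣF-zero zero    φ≈0 = refl
  ΣF-zero (suc N) φ≈0 = trans (+-cong (φ≈0 Fin.zero) (ΣF-zero N (λ r → φ≈0 (Fin.suc r)))) (+-identityˡ 0#)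

  ΣF-distrib-+ : ∀ N (φ ψ : Fin N → Carrier) → ΣF K N (λ r → φ r + ψ r) ≈ ΣF K N φ + ΣF K N ψ
  ΣF-distrib-+ zero    φ ψ = sym (+-identityˡ 0#)
  ΣF-distrib-+ (suc N) φ ψ = trans (+-congˡ (ΣF-distrib-+ N _ _)) (interchange _ _ _ _)

  Σ<-ΣF : ∀ N (f : ℕ → Carrier) (φ : Fin N → Carrier) → (∀ r → f (Fin.toℕ r) ≈ φ r) →
          Σ< K N f ≈ ΣF K N φ
  Σ<-ΣF zero    f φ f≈φ = refl
  Σ<-ΣF (suc N) f φ f≈φ =
    trans (Σ<-suc N f) (+-cong (f≈φ Fin.zero) (Σ<-ΣF N _ _ (λ r → f≈φ (Fin.suc r))))

  -- An enumeration of a half-line of ℤ in which the indices N a, …, N a + N − 1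
  -- (N = suc n) run through block a of ℤ, hitting every position exactly once.
  record Ray (n : ℕ) : Set (c ⊔ ℓ) where
    field
      point     : ℕ → ℤ
      block     : ℕ → ℤ
      blk-point : ∀ a {ρ} → ρ ℕ.< suc n → blk n (point (suc n ℕ.* a ℕ.+ ρ)) ≡ block a
      Σ<-pos-point : ∀ a (φ : Fin (suc n) → Carrier) →
        Σ< K (suc n) (λ ρ → φ (pos n (point (suc n ℕ.* a ℕ.+ ρ)))) ≈ ΣF K (suc n) φ
  open Ray

  positive-ray : ∀ n → Ray n
  positive-ray n = record
    { point        = λ i → + suc i
    ; block        = +_
    ; blk-point    = λ a ρ<N → proj₁ (blk-pos a ρ<N)
    ; Σ<-pos-point = λ a φ → Σ<-ΣF (suc n) _ φ (λ r →
        reflexive (≡.cong φ (FinP.toℕ-injective (proj₂ (blk-pos a (FinP.toℕ<n r))))))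
    }
    where
    blk-pos : ∀ a {ρ} → ρ ℕ.< suc n →
              blk n (+ suc (suc n ℕ.* a ℕ.+ ρ)) ≡ + a × Fin.toℕ (pos n (+ suc (suc n ℕ.* a ℕ.+ ρ))) ≡ ρ
    blk-pos a {ρ} ρ<N = blk-pos-unique n (+ suc (suc n ℕ.* a ℕ.+ ρ)) (+ a) ρ<N (positive-point n a ρ)

  nonpositive-ray : ∀ n → Ray n
  nonpositive-ray n = record
    { point        = λ i → ℤ.- + i
    ; block        = -[1+_]
    ; blk-point    = λ a ρ<N → proj₁ (blk-pos a ρ<N)
    ; Σ<-pos-point = λ a φ → trans (Σ<-reverse (suc n) _) (Σ<-ΣF (suc n) _ φ (λ r →
        reflexive (≡.cong φ (FinP.toℕ-injective (≡.trans (proj₂ (blk-pos a (n∸ρ<N (Fin.toℕ r))))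
                                                   (ℕP.m∸[m∸n]≡n (ℕP.≤-pred (FinP.toℕ<n r))))))))
    }
    where
    n∸ρ<N : ∀ ρ → n ℕ.∸ ρ ℕ.< suc n
    n∸ρ<N ρ = ℕ.s≤s (ℕP.m∸n≤m n ρ)
    blk-pos : ∀ a {ρ} → ρ ℕ.< suc n →
              blk n (ℤ.- + (suc n ℕ.* a ℕ.+ ρ)) ≡ -[1+ a ] ×
              Fin.toℕ (pos n (ℤ.- + (suc n ℕ.* a ℕ.+ ρ))) ≡ n ℕ.∸ ρ
    blk-pos a {ρ} ρ<N =
      blk-pos-unique n (ℤ.- + (suc n ℕ.* a ℕ.+ ρ)) -[1+ a ] (n∸ρ<N ρ) (nonpositive-point n a ρ (ℕP.≤-pred ρ<N))

  Σ<-rays : ∀ {n} (P Q : Ray n) k (G : ℤ → Fin (suc n) → Fin (suc n) → Carrier) →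
    Σ< K (suc n ℕ.* k) (λ i → Σ< K (suc n ℕ.* k) (λ j →
      G (blk n (point Q j) ℤ.- blk n (point P i)) (pos n (point P i)) (pos n (point Q j))))
    ≈ Σ< K k (λ a → Σ< K k (λ b →
      ΣF K (suc n) (λ r → ΣF K (suc n) (λ s → G (block Q b ℤ.- block P a) r s))))
  Σ<-rays {n} P Q k G = begin
    Σ< K (N ℕ.* k) (λ i → Σ< K (N ℕ.* k) (λ j → F (point P i) (point Q j)))
      ≈⟨ Σ<-blocks N k _ ⟩
    Σ< K k (λ a → Σ< K N (λ ρ → Σ< K (N ℕ.* k) (λ j → F (p a ρ) (point Q j))))
      ≈⟨ Σ<-cong k (λ a → Σ<-cong N (λ ρ → Σ<-blocks N k _)) ⟩
    Σ< K k (λ a → Σ< K N (λ ρ → Σ< K k (λ b → Σ< K N (λ σ → F (p a ρ) (q b σ)))))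
      ≈⟨ Σ<-cong k (λ a → Σ<-cong-< N (λ ρ ρ<N → Σ<-cong k (λ b → Σ<-cong-< N (λ σ σ<N →
           reflexive (≡.cong (λ m → G m (pos n (p a ρ)) (pos n (q b σ)))
                               (≡.cong₂ ℤ._-_ (blk-point Q b σ<N) (blk-point P a ρ<N))))))) ⟩
    Σ< K k (λ a → Σ< K N (λ ρ → Σ< K k (λ b → Σ< K N (λ σ → G (m a b) (pos n (p a ρ)) (pos n (q b σ))))))
      ≈⟨ Σ<-cong k (λ a → Σ<-comm N k _) ⟩
    Σ< K k (λ a → Σ< K k (λ b → Σ< K N (λ ρ → Σ< K N (λ σ → G (m a b) (pos n (p a ρ)) (pos n (q b σ))))))
      ≈⟨ Σ<-cong k (λ a → Σ<-cong k (λ b →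
           trans (Σ<-cong N (λ ρ → Σ<-pos-point Q b (G (m a b) (pos n (p a ρ)))))
                 (Σ<-pos-point P a (λ r → ΣF K N (G (m a b) r))))) ⟩
    Σ< K k (λ a → Σ< K k (λ b → ΣF K N (λ r → ΣF K N (λ s → G (m a b) r s)))) ∎
    where
    N = suc n
    F : ℤ → ℤ → Carrier
    F x y = G (blk n y ℤ.- blk n x) (pos n x) (pos n y)
    p q : ℕ → ℕ → ℤ
    p a ρ = point P (N ℕ.* a ℕ.+ ρ)
    q b σ = point Q (N ℕ.* b ℕ.+ σ)
    m : ℕ → ℕ → ℤ
    m a b = block Q b ℤ.- block P a

  module _ {N} (L : LieAlgebra K N) where
    open LieAlgebra L

    ad-cong : ∀ {x y : Vec K N} → (∀ a → x a ≈ y a) → ∀ r s → ad x r s ≈ ad y r s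
    ad-cong x≈y r s = ΣF-cong N (λ a → *-congʳ (x≈y a))

    ad-zero : ∀ {x : Vec K N} → (∀ a → x a ≈ 0#) → ∀ r s → ad x r s ≈ 0#
    ad-zero x≈0 r s = ΣF-zero N (λ a → trans (*-congʳ (x≈0 a)) (zeroˡ _))

    ad-distrib-+ : ∀ (x y : Vec K N) r s → ad (λ a → x a + y a) r s ≈ ad x r s + ad y r s
    ad-distrib-+ x y r s = trans (ΣF-cong N (λ a → distribʳ _ _ _)) (ΣF-distrib-+ N _ _)

    κ-zeroˡ : ∀ {x : Vec K N} y → (∀ a → x a ≈ 0#) → κ x y ≈ 0#
    κ-zeroˡ y x≈0 = ΣF-zero N (λ r → ΣF-zero N (λ s → trans (*-congʳ (ad-zero x≈0 r s)) (zeroˡ _)))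

  coeff-beyond-deg : ∀ {N} (X : Loop K N) {m} → deg K X ℕ.< ∣ m ∣ → ∀ r → coeff K X m r ≈ 0#
  coeff-beyond-deg []            _   r = refl
  coeff-beyond-deg ((m' , x) ∷ X) {m} deg<m r with m' ℤ.≟ m
  ... | yes ≡.refl = ⊥-elim (ℕP.<-irrefl ≡.refl (ℕP.≤-<-trans (ℕP.m≤m⊔n ∣ m ∣ (deg K X)) deg<m))
  ... | no  _      = coeff-beyond-deg X (ℕP.≤-<-trans (ℕP.m≤n⊔m ∣ m' ∣ (deg K X)) deg<m) r

  Φentry≈ad-coeff : ∀ {n} (L : LieAlgebra K (suc n)) (X : Loop K (suc n)) p q →
    Φentry K L X p q ≈ LieAlgebra.ad L (coeff K X (blk n q ℤ.- blk n p)) (pos n p) (pos n q)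
  Φentry≈ad-coeff L [] p q = sym (ad-zero L (λ _ → refl) _ _)
  Φentry≈ad-coeff {n} L ((m , x) ∷ X) p q
    with blk n q ℤ.- blk n p ℤ.≟ m | m ℤ.≟ (blk n q ℤ.- blk n p)
  ... | yes _  | yes _  = trans (+-congˡ (Φentry≈ad-coeff L X p q)) (sym (ad-distrib-+ L x (coeff K X (blk n q ℤ.- blk n p)) _ _))
  ... | no  _  | no  _  = trans (+-identityˡ _) (Φentry≈ad-coeff L X p q)
  ... | yes eq | no ne  = ⊥-elim (ne (≡.sym eq))
  ... | no ne  | yes eq = ⊥-elim (ne (≡.sym eq))

  module _ {n} (L : LieAlgebra K (suc n)) (X Y : Loop K (suc n)) where
    open LieAlgebra L

    pairing : ℤ → Carrier
    pairing m = κ (coeff K X m) (coeff K Y (ℤ.- m))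

    trace-summand : ℤ → Fin (suc n) → Fin (suc n) → Carrier
    trace-summand m r s = ad (coeff K X m) r s * ad (coeff K Y (ℤ.- m)) s r

    pairing-beyond-deg : ∀ {m} → deg K X ℕ.< ∣ m ∣ → pairing m ≈ 0#
    pairing-beyond-deg {m} deg<m = κ-zeroˡ L (coeff K Y (ℤ.- m)) (coeff-beyond-deg X deg<m)

    Φentry-product : ∀ p q → Φentry K L X p q * Φentry K L Y q p
                             ≈ trace-summand (blk n q ℤ.- blk n p) (pos n p) (pos n q)
    Φentry-product p q = *-cong (Φentry≈ad-coeff L X p q)
      (trans (Φentry≈ad-coeff L Y q p)
             (reflexive (≡.cong (λ m → ad (coeff K Y m) (pos n q) (pos n p)) (neg-diff (blk n q) (blk n p)))))
      where
      neg-diff : ∀ a b → b ℤ.- a ≡ ℤ.- (a ℤ.- b)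
      neg-diff = solve-∀

    Σ<-Φ-rays : (P Q : Ray n) (k : ℕ) →
      Σ< K (suc n ℕ.* k) (λ i → Σ< K (suc n ℕ.* k) (λ j →
        Φentry K L X (point P i) (point Q j) * Φentry K L Y (point Q j) (point P i)))
      ≈ Σ< K k (λ a → Σ< K k (λ b → pairing (block Q b ℤ.- block P a)))
    Σ<-Φ-rays P Q k = trans
      (Σ<-cong (suc n ℕ.* k) (λ i → Σ<-cong (suc n ℕ.* k) (λ j → Φentry-product (point P i) (point Q j))))
      (Σ<-rays P Q k trace-summand)

    cocycle-Φ≈u : cocycle K (Φ K L X) (Φ K L Y) ≈ u K L X Y
    cocycle-Φ≈u = begin
      cocycle K (Φ K L X) (Φ K L Y)
        ≈⟨ +-cong (Σ<-Φ-rays (nonpositive-ray n) (positive-ray n) (suc M))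
                  (-‿cong (Σ<-Φ-rays (positive-ray n) (nonpositive-ray n) (suc M))) ⟩
      Σ< K (suc M) (λ a → Σ< K (suc M) (λ b → pairing (+ b ℤ.- -[1+ a ])))
        - Σ< K (suc M) (λ a → Σ< K (suc M) (λ b → pairing (-[1+ b ] ℤ.- + a)))
        ≈⟨ +-cong (Σ<-cong (suc M) (λ a → Σ<-cong (suc M) (λ b → reflexive (≡.cong pairing (+m--[1+n]≡+[1+n+m] b a)))))
                  (-‿cong (Σ<-cong (suc M) (λ a → Σ<-cong (suc M) (λ b → reflexive (≡.cong pairing (-[1+m]-+n≡-[1+n+m] b a)))))) ⟩
      Σ< K (suc M) (λ a → Σ< K (suc M) (λ b → pairing (+ suc (a ℕ.+ b))))
        - Σ< K (suc M) (λ a → Σ< K (suc M) (λ b → pairing -[1+ (a ℕ.+ b) ]))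
        ≈⟨ +-cong (Σ<-antidiagonal (suc M) _ (λ j M≤j → pairing-beyond-deg (ℕ.s≤s M≤j)) (ℕP.n≤1+n M))
                  (-‿cong (Σ<-antidiagonal (suc M) _ (λ j M≤j → pairing-beyond-deg (ℕ.s≤s M≤j)) (ℕP.n≤1+n M))) ⟩
      Σ< K M (λ j → ℕ→K K (suc j) * pairing (+ suc j)) - Σ< K M (λ j → ℕ→K K (suc j) * pairing -[1+ j ])
        ≈⟨ Σ<-symmetric M pairing ⟨
      u K L X Y ∎
      where
      M = deg K X

theorem3p2 : ∀ {c ℓ} (K : CommutativeRing c ℓ) (N : ℕ) (L : LieAlgebra K N) →
             LieAlgebra.Semisimple L →
             (X Y : Loop K N) →
             CommutativeRing._≈_ K (cocycle K (Φ K L X) (Φ K L Y)) (u K L X Y)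
theorem3p2 K zero    L _ X Y = trans (-‿inverseʳ 0#) (sym (Σ<-zero K (suc (2 ℕ.* deg K X)) (λ _ → zeroʳ _)))
  where open CommutativeRing K
theorem3p2 K (suc n) L _ X Y = cocycle-Φ≈u K L X Y
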